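{- Let $\mathbf{A}=\langle A,\vee,\wedge,\ast,\to,\forall,\exists,0,1\rangle$ be a c-EBL-algebra with focal element $c$, and let $B=\exists A=\{\exists a: a\in A\}$. Then for every $a\in A$, $\forall a=\max\{b\in B: b\le c\to a\}$ and $\exists a=\min\{b\in B: c\ast a\le b\}$ (in particular these maximum and minimum exist).
   Context: A BL-algebra is an algebra $\langle A,\wedge,\vee,\ast,\to,0,1\rangle$ such that $\langle A,\wedge,\vee,0,1\rangle$ is a bounded lattice (order $\le$), $\langle A,\ast,1\rangle$ is a commutative monoid, $a\ast b\le c$ iff $a\le b\to c$, and $a\wedge b=a\ast(a\to b)$ and $(a\to b)\vee(b\to a)=1$ hold. An Epistemic BL-algebra (EBL-algebra) is a BL-algebra with unary operations $\forall,\exists$ satisfying, for all $a,b$: $\forall 1=1$; $\exists 0=0$; $\forall a\to\exists a=1$; $\forall(a\to\forall b)=\exists a\to\forall b$; $\forall(\forall a\to b)=\forall a\to\forall b$; $\exists a\to\forall\exists a=1$; $\forall(a\wedge b)=\forall a\wedge\forall b$; $\exists(a\vee b)=\exists a\vee\exists b$; $\exists(a\ast\exists b)=\exists a\ast\exists b$. If the set $\{a\in A:\forall a=1\}$ has a least element $c$, then $c$ is called the focal element of the EBL-algebra; a c-EBL-algebra is an EBL-algebra in which the focal element exists. (In any EBL-algebra, $\exists A=\forall A$ and it is a subalgebra.) -}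

module Defs where

open import Level using (Level; suc)
open import Data.Product using (Σ; _×_)
open import Relation.Binary.PropositionalEquality using (_≡_)
open import Algebra.Lattice.Structures using (IsLattice)
open import Algebra.Structures using (IsCommutativeMonoid)

record BLAlgebra (ℓ : Level) : Set (suc ℓ) where
  infixr 6 _∨_
  infixr 7 _∧_
  infixr 7 _*_
  infixr 5 _⇒_
  infix 4 _≤_
  field
    Carrier : Set ℓ
    _∨_ _∧_ _*_ _⇒_ : Carrier → Carrier → Carrier
    𝟘 𝟙 : Carrier
    isLattice : IsLattice _≡_ _∨_ _∧_

  _≤_ : Carrier → Carrier → Set ℓ
  a ≤ b = a ∧ b ≡ a

  field
    bottom : ∀ a → 𝟘 ≤ a
    top : ∀ a → a ≤ 𝟙
    isCommutativeMonoid : IsCommutativeMonoid _≡_ _*_ 𝟙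
    residuation⇒ : ∀ a b c → a * b ≤ c → a ≤ (b ⇒ c)
    residuation⇐ : ∀ a b c → a ≤ (b ⇒ c) → a * b ≤ c
    divisibility : ∀ a b → a ∧ b ≡ a * (a ⇒ b)
    prelinearity : ∀ a b → (a ⇒ b) ∨ (b ⇒ a) ≡ 𝟙

record EBLAlgebra (ℓ : Level) : Set (suc ℓ) where
  field
    bl : BLAlgebra ℓ
  open BLAlgebra bl public
  field
    univ exist : Carrier → Carrier
    univ-𝟙 : univ 𝟙 ≡ 𝟙
    exist-𝟘 : exist 𝟘 ≡ 𝟘
    e3 : ∀ a → (univ a ⇒ exist a) ≡ 𝟙
    e4 : ∀ a b → univ (a ⇒ univ b) ≡ (exist a ⇒ univ b)
    e5 : ∀ a b → univ (univ a ⇒ b) ≡ (univ a ⇒ univ b)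
    e6 : ∀ a → (exist a ⇒ univ (exist a)) ≡ 𝟙
    e7 : ∀ a b → univ (a ∧ b) ≡ univ a ∧ univ b
    e8 : ∀ a b → exist (a ∨ b) ≡ exist a ∨ exist b
    e9 : ∀ a b → exist (a * exist b) ≡ exist a * exist b

  InB : Carrier → Set ℓ
  InB b = Σ Carrier (λ x → b ≡ exist x)

  IsFocal : Carrier → Set ℓ
  IsFocal c = (univ c ≡ 𝟙) × (∀ x → univ x ≡ 𝟙 → c ≤ x)

  IsMaxOf : (Carrier → Set ℓ) → Carrier → Set ℓ
  IsMaxOf S m = S m × (∀ b → S b → b ≤ m)

  IsMinOf : (Carrier → Set ℓ) → Carrier → Set ℓ
  IsMinOf S m = S m × (∀ b → S b → m ≤ b)

{-# OPTIONS --safe #-}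
module Submission where

-- For b ∈ B the axioms give ∀(b → a) = b → ∀a and ∀(a → b) = ∃a → b, and ∀x = 1
-- holds exactly when c ≤ x.  Hence, for b ∈ B,
--   b ≤ ∀a  iff  ∀(b → a) = 1  iff  c ≤ b → a  iff  b ≤ c → a,
--   ∃a ≤ b  iff  ∀(a → b) = 1  iff  c ≤ a → b  iff  c ∗ a ≤ b,
-- and ∀a, ∃a themselves lie in B.

open import Defs
open import Level using (Level)
open import Data.Product using (_×_; _,_; proj₁; proj₂)
open import Relation.Binary.PropositionalEquality
  using (_≡_; refl; sym; trans; cong; subst)
open import Algebra.Lattice.Bundles using (Lattice)
open import Algebra.Lattice.Structures using (IsLattice)
open import Algebra.Structures using (IsCommutativeMonoid)
import Algebra.Lattice.Properties.Lattice as LatticeProperties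

module BLAlgebraProperties {ℓ : Level} (B : BLAlgebra ℓ) where
  open BLAlgebra B
  open IsLattice isLattice using (∧-comm; ∧-assoc)
  open IsCommutativeMonoid isCommutativeMonoid using (identityˡ; comm)

  lattice : Lattice ℓ ℓ
  lattice = record { isLattice = isLattice }

  open LatticeProperties lattice using (∧-idem)

  ≤-refl : ∀ x → x ≤ x
  ≤-refl = ∧-idem

  ≤-antisym : ∀ {x y} → x ≤ y → y ≤ x → x ≡ y
  ≤-antisym {x} {y} p q = trans (sym p) (trans (∧-comm x y) q)

  ≤-trans : ∀ {x y z} → x ≤ y → y ≤ z → x ≤ z
  ≤-trans {x} {y} {z} p q = trans (cong (_∧ z) (sym p))
    (trans (∧-assoc x y z) (trans (cong (x ∧_) q) p))

  𝟙-maximum : ∀ {x} → 𝟙 ≤ x → x ≡ 𝟙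
  𝟙-maximum {x} = ≤-antisym (top x)

  ≤→⇒≡𝟙 : ∀ {x y} → x ≤ y → (x ⇒ y) ≡ 𝟙
  ≤→⇒≡𝟙 {x} {y} p =
    𝟙-maximum (residuation⇒ 𝟙 x y (subst (_≤ y) (sym (identityˡ x)) p))

  ⇒≡𝟙→≤ : ∀ {x y} → (x ⇒ y) ≡ 𝟙 → x ≤ y
  ⇒≡𝟙→≤ {x} {y} e = subst (_≤ y) (identityˡ x)
    (residuation⇐ 𝟙 x y (subst (𝟙 ≤_) (sym e) (≤-refl 𝟙)))

  ⇒-swap : ∀ {x y z} → x ≤ (y ⇒ z) → y ≤ (x ⇒ z)
  ⇒-swap {x} {y} {z} p =
    residuation⇒ y x z (subst (_≤ z) (comm x y) (residuation⇐ x y z p))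

module EBLAlgebraProperties {ℓ : Level} (A : EBLAlgebra ℓ) where
  open EBLAlgebra A
  open BLAlgebraProperties bl
  open IsCommutativeMonoid isCommutativeMonoid using (identityˡ)

  exist-𝟙 : exist 𝟙 ≡ 𝟙
  exist-𝟙 = 𝟙-maximum (⇒≡𝟙→≤ (subst (λ u → (u ⇒ exist 𝟙) ≡ 𝟙) univ-𝟙 (e3 𝟙)))

  exist-idem : ∀ x → exist (exist x) ≡ exist x
  exist-idem x = trans (cong exist (sym (identityˡ (exist x))))
    (trans (e9 𝟙 x) (trans (cong (_* exist x) exist-𝟙) (identityˡ (exist x))))

  univ-exist : ∀ x → univ (exist x) ≡ exist x
  univ-exist x = ≤-antisym
    (subst (univ (exist x) ≤_) (exist-idem x) (⇒≡𝟙→≤ (e3 (exist x))))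
    (⇒≡𝟙→≤ (e6 x))

  univ-mono : ∀ {x y} → x ≤ y → univ x ≤ univ y
  univ-mono {x} {y} p = trans (sym (e7 x y)) (cong univ p)

  univ≤univ-univ : ∀ x → univ x ≤ univ (univ x)
  univ≤univ-univ x =
    ⇒≡𝟙→≤ (trans (sym (e5 x (univ x))) (trans (cong univ (≤→⇒≡𝟙 (≤-refl (univ x)))) univ-𝟙))

  univ-inB : ∀ x → InB (univ x)
  univ-inB x = univ x , ≤-antisym
    (≤-trans (univ≤univ-univ x) (⇒≡𝟙→≤ (e3 (univ x))))
    (⇒≡𝟙→≤ (trans (sym (e4 (univ x) x)) (trans (cong univ (≤→⇒≡𝟙 (≤-refl (univ x)))) univ-𝟙)))

  univ-⇒-fromB : ∀ {b} a → InB b → univ (b ⇒ a) ≡ (b ⇒ univ a)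
  univ-⇒-fromB a (x , refl) =
    subst (λ u → univ (u ⇒ a) ≡ (u ⇒ univ a)) (univ-exist x) (e5 (exist x) a)

  univ-⇒-intoB : ∀ {b} a → InB b → univ (a ⇒ b) ≡ (exist a ⇒ b)
  univ-⇒-intoB a (x , refl) =
    subst (λ u → univ (a ⇒ u) ≡ (exist a ⇒ u)) (univ-exist x) (e4 a (exist x))

  module Focal (c : Carrier) (focal : IsFocal c) where

    focal≤→univ≡𝟙 : ∀ {x} → c ≤ x → univ x ≡ 𝟙
    focal≤→univ≡𝟙 {x} p = 𝟙-maximum (subst (_≤ univ x) (proj₁ focal) (univ-mono p))

    univ≡𝟙→focal≤ : ∀ {x} → univ x ≡ 𝟙 → c ≤ x
    univ≡𝟙→focal≤ = proj₂ focal _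

    univ-isMax : ∀ a → IsMaxOf (λ b → InB b × (b ≤ (c ⇒ a))) (univ a)
    univ-isMax a = (univ-inB a , ⇒-swap c≤univ-a⇒a) , maximal
      where
      c≤univ-a⇒a : c ≤ (univ a ⇒ a)
      c≤univ-a⇒a = univ≡𝟙→focal≤
        (trans (univ-⇒-fromB a (univ-inB a)) (≤→⇒≡𝟙 (≤-refl (univ a))))

      maximal : ∀ b → InB b × (b ≤ (c ⇒ a)) → b ≤ univ a
      maximal b (b∈B , b≤c⇒a) =
        ⇒≡𝟙→≤ (trans (sym (univ-⇒-fromB a b∈B)) (focal≤→univ≡𝟙 (⇒-swap b≤c⇒a)))

    exist-isMin : ∀ a → IsMinOf (λ b → InB b × ((c * a) ≤ b)) (exist a)
    exist-isMin a = ((a , refl) , residuation⇐ c a (exist a) c≤a⇒exist-a) , minimal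
      where
      c≤a⇒exist-a : c ≤ (a ⇒ exist a)
      c≤a⇒exist-a = univ≡𝟙→focal≤
        (trans (univ-⇒-intoB a (a , refl)) (≤→⇒≡𝟙 (≤-refl (exist a))))

      minimal : ∀ b → InB b × ((c * a) ≤ b) → exist a ≤ b
      minimal b (b∈B , c*a≤b) =
        ⇒≡𝟙→≤ (trans (sym (univ-⇒-intoB a b∈B))
          (focal≤→univ≡𝟙 (residuation⇒ c a b c*a≤b)))

theorem7 : {ℓ : Level} (A : EBLAlgebra ℓ) → let open EBLAlgebra A in
    (c : Carrier) → IsFocal c → (a : Carrier) →
      IsMaxOf (λ b → InB b × (b ≤ (c ⇒ a))) (univ a)
      × IsMinOf (λ b → InB b × ((c * a) ≤ b)) (exist a)
theorem7 A c focal a = univ-isMax a , exist-isMin a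
  where open EBLAlgebraProperties.Focal A c focal
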